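{- For every integer $k\ge 1$ and every $i\ge \lfloor \log_2 k\rfloor+1$, the value $2^k$ appears exactly $2^{\,i-1-\lfloor \log_2 k\rfloor}$ times in the sequence $R_i$.
   Context: Define integer sequences $R_0=\langle 1\rangle$, $\phi_i=\langle 2^{2^{i-1}},2^{2^{i-1}+1},\dots,2^{2^i-1}\rangle$ for $i\ge 1$, and $R_i=R_{i-1}\|R_{i-1}\|\phi_i$ for $i\ge1$, where $\|$ denotes concatenation. E.g. $R_1=\langle1,1,2\rangle$, $R_2=\langle 1,1,2,1,1,2,4,8\rangle$. -}

module Defs where

open import Data.Nat using (ℕ; zero; suc; _+_; _∸_; _^_)
open import Data.List using (List; [_]; _++_; map; upTo)

φ : ℕ → List ℕ
φ i = map (λ j → 2 ^ (2 ^ (i ∸ 1) + j)) (upTo (2 ^ (i ∸ 1)))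

R : ℕ → List ℕ
R zero = [ 1 ]
R (suc i) = R i ++ R i ++ φ (suc i)

module Submission where

open import Defs
open import Data.Nat using (ℕ; suc; _+_; _∸_; _^_; _≤_; _≟_)
open import Data.Nat.Logarithm using (⌊log₂_⌋)
open import Data.List using (length; filter)
open import Relation.Binary.PropositionalEquality using (_≡_)

open import Data.Nat using (zero; _*_; _<_; z≤n; s≤s; z<s; s<s; ⌊_/2⌋; NonZero; >-nonZero)
open import Data.Nat.Properties
open import Data.Nat.Logarithm using (⌊log₂[2^n]⌋≡n; ⌊log₂⌋-mono-≤)
open import Data.Nat.Logarithm.Core using (⌊log2⌋)
open import Data.Nat.Induction using (<-wellFounded)
open import Induction.WellFounded using (Acc; acc)
open import Data.List using (List; _++_; applyUpTo)
open import Data.List.Properties using (filter-++; length-++; map-upTo; filter-accept; filter-reject)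
open import Data.Sum using (_⊎_; inj₁; inj₂)
open import Function using (_∘_)
open import Relation.Binary.PropositionalEquality using (_≢_; refl; sym; trans; cong; cong₂; subst; module ≡-Reasoning)

-- The multiplicity of 2^k obeys  #R_{j+1} = 2·#R_j + #φ_{j+1}.  The exponents
-- in φ_{j+1} are exactly the integers of [2^j, 2^{j+1}), each once, so with
-- L = ⌊log₂ k⌋ the power 2^k occurs in φ_{L+1} and in no other φ_j.  Hence it
-- is absent from R_0, …, R_L, occurs once in R_{L+1}, and doubles afterwards.

2^-injective : ∀ {m n} → 2 ^ m ≡ 2 ^ n → m ≡ n
2^-injective {m} {n} eq = begin
  m                  ≡⟨ sym (⌊log₂[2^n]⌋≡n m) ⟩
  ⌊log₂ (2 ^ m) ⌋    ≡⟨ cong ⌊log₂_⌋ eq ⟩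
  ⌊log₂ (2 ^ n) ⌋    ≡⟨ ⌊log₂[2^n]⌋≡n n ⟩
  n                  ∎
  where open ≡-Reasoning

2*⌊n/2⌋≤n : ∀ n → 2 * ⌊ n /2⌋ ≤ n
2*⌊n/2⌋≤n zero          = z≤n
2*⌊n/2⌋≤n (suc zero)    = z≤n
2*⌊n/2⌋≤n (suc (suc n)) rewrite +-suc ⌊ n /2⌋ (⌊ n /2⌋ + 0) = s≤s (s≤s (2*⌊n/2⌋≤n n))

2^⌊log2⌋≤n : ∀ n .{{_ : NonZero n}} (rec : Acc _<_ n) → 2 ^ ⌊log2⌋ n rec ≤ n
2^⌊log2⌋≤n (suc zero)    _         = s≤s z≤n
2^⌊log2⌋≤n (suc (suc n)) (acc rec) =
  ≤-trans (*-monoʳ-≤ 2 (2^⌊log2⌋≤n (suc ⌊ n /2⌋) (rec (⌊n/2⌋<n (suc n))))) (2*⌊n/2⌋≤n (suc (suc n)))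

2^⌊log₂n⌋≤n : ∀ n .{{_ : NonZero n}} → 2 ^ ⌊log₂ n ⌋ ≤ n
2^⌊log₂n⌋≤n n = 2^⌊log2⌋≤n n (<-wellFounded n)

n<2^[1+⌊log₂n⌋] : ∀ n → n < 2 ^ suc ⌊log₂ n ⌋
n<2^[1+⌊log₂n⌋] n = ≰⇒> λ 2^[1+⌊log₂n⌋]≤n → n≮n ⌊log₂ n ⌋
  (subst (_≤ ⌊log₂ n ⌋) (⌊log₂[2^n]⌋≡n (suc ⌊log₂ n ⌋)) (⌊log₂⌋-mono-≤ 2^[1+⌊log₂n⌋]≤n))

count : ℕ → List ℕ → ℕ
count x xs = length (filter (_≟ x) xs)

count-++ : ∀ x xs ys → count x (xs ++ ys) ≡ count x xs + count x ys
count-++ x xs ys = trans (cong length (filter-++ (_≟ x) xs ys)) (length-++ (filter (_≟ x) xs))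

count-applyUpTo-absent : ∀ x n (f : ℕ → ℕ) → (∀ j → j < n → f j ≢ x) →
                         count x (applyUpTo f n) ≡ 0
count-applyUpTo-absent x zero    f absent = refl
count-applyUpTo-absent x (suc n) f absent =
  trans (cong length (filter-reject (_≟ x) (absent 0 z<s)))
        (count-applyUpTo-absent x n (f ∘ suc) (λ j j<n → absent (suc j) (s<s j<n)))

count-applyUpTo-unique : ∀ x n (f : ℕ → ℕ) c → c < n → f c ≡ x → (∀ j → f j ≡ x → j ≡ c) →
                         count x (applyUpTo f n) ≡ 1
count-applyUpTo-unique x (suc n) f zero    _         fc≡x unique =
  trans (cong length (filter-accept (_≟ x) fc≡x))
        (cong suc (count-applyUpTo-absent x n (f ∘ suc) (λ j _ eq → 1+n≢0 (unique (suc j) eq))))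
count-applyUpTo-unique x (suc n) f (suc c) (s<s c<n) fc≡x unique =
  trans (cong length (filter-reject (_≟ x) (λ eq → 0≢1+n (unique 0 eq))))
        (count-applyUpTo-unique x n (f ∘ suc) c c<n fc≡x (λ j eq → suc-injective (unique (suc j) eq)))

φ-suc≡applyUpTo : ∀ j → φ (suc j) ≡ applyUpTo (λ m → 2 ^ (2 ^ j + m)) (2 ^ j)
φ-suc≡applyUpTo j = map-upTo (λ m → 2 ^ (2 ^ j + m)) (2 ^ j)

count-φ-outside : ∀ k j → k < 2 ^ j ⊎ 2 ^ suc j ≤ k → count (2 ^ k) (φ (suc j)) ≡ 0
count-φ-outside k j outside = trans (cong (count (2 ^ k)) (φ-suc≡applyUpTo j))
  (count-applyUpTo-absent (2 ^ k) (2 ^ j) _ λ m m<2^j eq → not-exponent m<2^j outside (2^-injective eq))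
  where
  not-exponent : ∀ {m} → m < 2 ^ j → k < 2 ^ j ⊎ 2 ^ suc j ≤ k → 2 ^ j + m ≢ k
  not-exponent {m} _     (inj₁ k<2^j)    e = <⇒≱ k<2^j (subst (2 ^ j ≤_) e (m≤m+n (2 ^ j) m))
  not-exponent {m} m<2^j (inj₂ 2^[1+j]≤k) e = <-irrefl refl (begin-strict
    k                   ≡⟨ sym e ⟩
    2 ^ j + m           <⟨ +-monoʳ-< (2 ^ j) m<2^j ⟩
    2 ^ j + 2 ^ j       ≡⟨ cong (2 ^ j +_) (sym (+-identityʳ (2 ^ j))) ⟩
    2 ^ suc j           ≤⟨ 2^[1+j]≤k ⟩
    k                   ∎)
    where open ≤-Reasoning

count-φ-inside : ∀ k j → 2 ^ j ≤ k → k < 2 ^ suc j → count (2 ^ k) (φ (suc j)) ≡ 1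
count-φ-inside k j 2^j≤k k<2^[1+j] = trans (cong (count (2 ^ k)) (φ-suc≡applyUpTo j))
  (count-applyUpTo-unique (2 ^ k) (2 ^ j) _ (k ∸ 2 ^ j) offset<2^j
    (cong (2 ^_) (m+[n∸m]≡n 2^j≤k))
    (λ m eq → sym (trans (cong (_∸ 2 ^ j) (sym (2^-injective eq))) (m+n∸m≡n (2 ^ j) m))))
  where
  offset<2^j : k ∸ 2 ^ j < 2 ^ j
  offset<2^j = subst (k ∸ 2 ^ j <_) (m+n∸m≡n (2 ^ j) (2 ^ j))
    (∸-monoˡ-< (subst (k <_) (cong (2 ^ j +_) (+-identityʳ (2 ^ j))) k<2^[1+j]) 2^j≤k)

count-R-suc : ∀ x j → count x (R (suc j)) ≡ 2 * count x (R j) + count x (φ (suc j))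
count-R-suc x j = begin
  count x (R j ++ R j ++ φ (suc j))  ≡⟨ count-++ x (R j) _ ⟩
  c + count x (R j ++ φ (suc j))     ≡⟨ cong (c +_) (count-++ x (R j) _) ⟩
  c + (c + p)                        ≡⟨ sym (+-assoc c c p) ⟩
  c + c + p                          ≡⟨ cong (λ t → c + t + p) (sym (+-identityʳ c)) ⟩
  2 * c + p                          ∎
  where
  open ≡-Reasoning
  c p : ℕ
  c = count x (R j)
  p = count x (φ (suc j))

module _ (k : ℕ) (1≤k : 1 ≤ k) where

  private
    L : ℕ
    L = ⌊log₂ k ⌋

    2^L≤k : 2 ^ L ≤ k
    2^L≤k = 2^⌊log₂n⌋≤n k {{>-nonZero 1≤k}}

  count-R-below : ∀ j → j ≤ L → count (2 ^ k) (R j) ≡ 0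
  count-R-below zero    _     =
    cong length (filter-reject (_≟ 2 ^ k) (λ 1≡2^k → <⇒≢ 1≤k (2^-injective {0} 1≡2^k)))
  count-R-below (suc j) 1+j≤L = begin
    count (2 ^ k) (R (suc j))                               ≡⟨ count-R-suc (2 ^ k) j ⟩
    2 * count (2 ^ k) (R j) + count (2 ^ k) (φ (suc j))     ≡⟨ cong₂ (λ a b → 2 * a + b)
                                                                 (count-R-below j (<⇒≤ 1+j≤L))
                                                                 (count-φ-outside k j (inj₂ 2^[1+j]≤k)) ⟩
    0                                                       ∎
    where
    open ≡-Reasoning
    2^[1+j]≤k : 2 ^ suc j ≤ k
    2^[1+j]≤k = ≤-trans (^-monoʳ-≤ 2 1+j≤L) 2^L≤k

  count-R-above : ∀ d → count (2 ^ k) (R (d + suc L)) ≡ 2 ^ d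
  count-R-above zero    = begin
    count (2 ^ k) (R (suc L))                               ≡⟨ count-R-suc (2 ^ k) L ⟩
    2 * count (2 ^ k) (R L) + count (2 ^ k) (φ (suc L))     ≡⟨ cong₂ (λ a b → 2 * a + b)
                                                                 (count-R-below L ≤-refl)
                                                                 (count-φ-inside k L 2^L≤k (n<2^[1+⌊log₂n⌋] k)) ⟩
    1                                                       ∎
    where open ≡-Reasoning
  count-R-above (suc d) = begin
    count (2 ^ k) (R (suc i))                               ≡⟨ count-R-suc (2 ^ k) i ⟩
    2 * count (2 ^ k) (R i) + count (2 ^ k) (φ (suc i))     ≡⟨ cong₂ (λ a b → 2 * a + b)
                                                                 (count-R-above d)
                                                                 (count-φ-outside k i (inj₁ k<2^i)) ⟩
    2 * 2 ^ d + 0                                           ≡⟨ +-identityʳ (2 ^ suc d) ⟩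
    2 ^ suc d                                               ∎
    where
    open ≡-Reasoning
    i : ℕ
    i = d + suc L
    k<2^i : k < 2 ^ i
    k<2^i = <-≤-trans (n<2^[1+⌊log₂n⌋] k) (^-monoʳ-≤ 2 (m≤n+m (suc L) d))

mainTheorem6 : ∀ (k i : ℕ) → 1 ≤ k → ⌊log₂ k ⌋ + 1 ≤ i →
    length (filter (_≟ 2 ^ k) (R i)) ≡ 2 ^ (i ∸ 1 ∸ ⌊log₂ k ⌋)
mainTheorem6 k i 1≤k L+1≤i = begin
  count (2 ^ k) (R i)                    ≡⟨ cong (count (2 ^ k) ∘ R) (sym (m∸n+n≡m 1+L≤i)) ⟩
  count (2 ^ k) (R (i ∸ suc L + suc L))  ≡⟨ count-R-above k 1≤k (i ∸ suc L) ⟩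
  2 ^ (i ∸ suc L)                        ≡⟨ cong (2 ^_) (sym (∸-+-assoc i 1 L)) ⟩
  2 ^ (i ∸ 1 ∸ L)                        ∎
  where
  open ≡-Reasoning
  L : ℕ
  L = ⌊log₂ k ⌋
  1+L≤i : suc L ≤ i
  1+L≤i = subst (_≤ i) (+-comm L 1) L+1≤i
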